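{- Let $G^+=(V,E^+)$ be a finite simple undirected graph, $\phi\ge0$, $0\le\eta<1$, and let $\mathcal{C}^*$ be a clustering with $\mathrm{obj}(\mathcal{C}^*)\le\phi$. Let $u,v$ be vertices with $\deg(u),\deg(v)>(3+\eta)\phi$ and $\mathcal{C}^*_u\ne\mathcal{C}^*_v$, and let $w\in\mathcal{C}^*_u$ be a vertex with $\deg(w)\le(3+\eta)\phi$. Suppose $|N[w]\cap N[v]\cap N[u]|=\phi+t$ for some $t>0$. Then $|N[w]\Delta N[u]|\le 2(\phi-t)$.
   Context: For $u\in V$, $N(u)$ is the set of neighbours of $u$ in $G^+$, $\deg(u)=|N(u)|$, and $N[u]=N(u)\cup\{u\}$. $\Delta$ denotes symmetric difference. A clustering $\mathcal{C}$ is a partition of $V$, and $\mathcal{C}_u$ denotes the cluster containing $u$. The disagreement of $u$ is $\rho_{\mathcal{C}}(u)=|N[u]\Delta\mathcal{C}_u|$, and $\mathrm{obj}(\mathcal{C})=\max_u\rho_{\mathcal{C}}(u)$.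
   Formalization: The parameters φ, η and t range over the rationals. -}

module Defs where

open import Data.Nat using (ℕ; suc)
open import Data.Bool using (Bool; true; false; if_then_else_)
open import Data.Fin using (Fin)
open import Data.Fin.Subset using (Subset; inside; outside; ⁅_⁆; _∪_; _∩_; _─_; ∣_∣)
open import Data.Vec using (tabulate)
open import Data.Integer using (+_)
open import Data.Rational using (ℚ; _/_; _⊔_)
open import Relation.Binary.PropositionalEquality using (_≡_)
open import Relation.Nullary using (¬_)
open import Relation.Nullary.Decidable using (⌊_⌋)
open import Data.Fin using (_≟_)

record Graph (n : ℕ) : Set where
  field
    adj       : Fin n → Fin n → Bool
    adj-sym   : ∀ x y → adj x y ≡ adj y x
    adj-irrefl : ∀ x → adj x x ≡ false
open Graph public

N : ∀ {n} → Graph n → Fin n → Subset n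
N G u = tabulate (λ x → if adj G u x then inside else outside)

N[_] : ∀ {n} → Graph n → Fin n → Subset n
N[ G ] u = N G u ∪ ⁅ u ⁆

deg : ∀ {n} → Graph n → Fin n → ℕ
deg G u = ∣ N G u ∣

_Δ_ : ∀ {n} → Subset n → Subset n → Subset n
A Δ B = (A ─ B) ∪ (B ─ A)

-- A clustering (partition of V) is given by a labelling of vertices; two
-- vertices are in the same cluster iff they have the same label.
Clustering : ℕ → Set
Clustering n = Fin n → Fin n

cluster : ∀ {n} → Clustering n → Fin n → Subset n
cluster C u = tabulate (λ x → if ⌊ C x ≟ C u ⌋ then inside else outside)

ρ : ∀ {n} → Graph n → Clustering n → Fin n → ℕ
ρ G C u = ∣ N[ G ] u Δ cluster C u ∣

toℚ : ℕ → ℚ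
toℚ k = (+ k) / 1

{-# OPTIONS --safe #-}
-- Split T = N[w] ∩ N[v] ∩ N[u] along the common cluster 𝒞*_w = 𝒞*_u.  A vertex of T inside
-- it lies outside 𝒞*_v, so it is a disagreement of v.  A vertex of T outside it is a
-- disagreement of both w and u, yet is not in N[w] Δ N[u], so it is counted twice on the right of
-- the triangle inequality |N[w] Δ N[u]| ≤ ρ(w) + ρ(u) through that cluster but not on the left.
-- Hence |N[w] Δ N[u]| + 2|T| ≤ ρ(w) + ρ(u) + 2ρ(v) ≤ 4φ, and |T| = φ + t gives the bound.
module Submission where

open import Defs
open import Data.Nat using (ℕ)
open import Data.Fin using (Fin)
open import Data.Fin.Subset using (∣_∣; _∩_)
open import Relation.Binary.PropositionalEquality using (_≡_; _≢_)

open import Data.Product using (_,_)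
open import Relation.Binary.PropositionalEquality using (refl; sym; trans; cong; cong₂; subst₂)

module SubsetCounting where
  open import Data.Nat
  open import Data.Nat.Properties
  open import Data.Nat.Tactic.RingSolver using (solve-∀)
  open import Algebra.Properties.CommutativeSemigroup +-commutativeSemigroup using (interchange)
  open import Data.Fin.Subset
  open import Data.Fin.Subset.Properties
  open import Data.Vec using ([]; _∷_; here; there)
  open ≤-Reasoning

  variable
    n : ℕ
    x : Fin n
    p q : Subset n

  ∣p∣≡∣p─q∣+∣p∩q∣ : ∀ (p q : Subset n) → ∣ p ∣ ≡ ∣ p ─ q ∣ + ∣ p ∩ q ∣
  ∣p∣≡∣p─q∣+∣p∩q∣ []            []            = refl
  ∣p∣≡∣p─q∣+∣p∩q∣ (inside  ∷ p) (inside  ∷ q) = trans (cong suc (∣p∣≡∣p─q∣+∣p∩q∣ p q)) (sym (+-suc _ _))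
  ∣p∣≡∣p─q∣+∣p∩q∣ (inside  ∷ p) (outside ∷ q) = cong suc (∣p∣≡∣p─q∣+∣p∩q∣ p q)
  ∣p∣≡∣p─q∣+∣p∩q∣ (outside ∷ p) (inside  ∷ q) = ∣p∣≡∣p─q∣+∣p∩q∣ p q
  ∣p∣≡∣p─q∣+∣p∩q∣ (outside ∷ p) (outside ∷ q) = ∣p∣≡∣p─q∣+∣p∩q∣ p q

  x∈p─q⇒x∉q : x ∈ p ─ q → x ∉ q
  x∈p─q⇒x∉q {p = inside ∷ _} {q = outside ∷ _} here      ()
  x∈p─q⇒x∉q {p = _ ∷ _}      {q = _ ∷ _}       (there i) (there j) = x∈p─q⇒x∉q i j

  ─-monoˡ-⊆ : ∀ r → p ⊆ q → p ─ r ⊆ q ─ r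
  ─-monoˡ-⊆ {p = p} r p⊆q x∈p─r = x∈p∧x∉q⇒x∈p─q (p⊆q (p─q⊆p p r x∈p─r)) (x∈p─q⇒x∉q x∈p─r)

  ∣pΔq∣+2∣p∩q─r∣≤∣pΔr∣+∣qΔr∣ : ∀ (p q r : Subset n) →
                                ∣ p Δ q ∣ + 2 * ∣ p ∩ q ─ r ∣ ≤ ∣ p Δ r ∣ + ∣ q Δ r ∣
  ∣pΔq∣+2∣p∩q─r∣≤∣pΔr∣+∣qΔr∣ []      []      []      = z≤n
  ∣pΔq∣+2∣p∩q─r∣≤∣pΔr∣+∣qΔr∣ (x ∷ p) (y ∷ q) (z ∷ r) = ∷-step x y z
    where
    add-head : ∀ a b c d → a + 2 * b ≤ c + d →
               (a + ∣ p Δ q ∣) + 2 * (b + ∣ p ∩ q ─ r ∣) ≤ (c + ∣ p Δ r ∣) + (d + ∣ q Δ r ∣)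
    add-head a b c d h = begin
      (a + ∣ p Δ q ∣) + 2 * (b + ∣ p ∩ q ─ r ∣)      ≡⟨ regroup a (∣ p Δ q ∣) b (∣ p ∩ q ─ r ∣) ⟩
      (a + 2 * b) + (∣ p Δ q ∣ + 2 * ∣ p ∩ q ─ r ∣)  ≤⟨ +-mono-≤ h (∣pΔq∣+2∣p∩q─r∣≤∣pΔr∣+∣qΔr∣ p q r) ⟩
      (c + d) + (∣ p Δ r ∣ + ∣ q Δ r ∣)              ≡⟨ interchange c d (∣ p Δ r ∣) (∣ q Δ r ∣) ⟩
      (c + ∣ p Δ r ∣) + (d + ∣ q Δ r ∣)              ∎
      where
      regroup : ∀ a a′ b b′ → (a + a′) + 2 * (b + b′) ≡ (a + 2 * b) + (a′ + 2 * b′)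
      regroup = solve-∀

    ∷-step : ∀ x y z → ∣ (x ∷ p) Δ (y ∷ q) ∣ + 2 * ∣ (x ∷ p) ∩ (y ∷ q) ─ (z ∷ r) ∣
                       ≤ ∣ (x ∷ p) Δ (z ∷ r) ∣ + ∣ (y ∷ q) Δ (z ∷ r) ∣
    ∷-step inside  inside  inside  = add-head 0 0 0 0 z≤n
    ∷-step inside  inside  outside = add-head 0 1 1 1 ≤-refl
    ∷-step inside  outside inside  = add-head 1 0 0 1 ≤-refl
    ∷-step inside  outside outside = add-head 1 0 1 0 ≤-refl
    ∷-step outside inside  inside  = add-head 1 0 1 0 ≤-refl
    ∷-step outside inside  outside = add-head 1 0 0 1 ≤-refl
    ∷-step outside outside inside  = add-head 0 0 1 1 z≤n
    ∷-step outside outside outside = add-head 0 0 0 0 z≤n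

  ∣pΔq∣+2∣p∩s∩q∣≤∣pΔr∣+∣qΔr∣+2∣sΔt∣ : ∀ (p q r s t : Subset n) → (∀ {x} → x ∈ r → x ∉ t) →
    ∣ p Δ q ∣ + 2 * ∣ p ∩ s ∩ q ∣ ≤ ∣ p Δ r ∣ + ∣ q Δ r ∣ + 2 * ∣ s Δ t ∣
  ∣pΔq∣+2∣p∩s∩q∣≤∣pΔr∣+∣qΔr∣+2∣sΔt∣ p q r s t r∩t=∅ = begin
    ∣ p Δ q ∣ + 2 * ∣ T ∣                                ≡⟨ cong (λ k → ∣ p Δ q ∣ + 2 * k) (∣p∣≡∣p─q∣+∣p∩q∣ T r) ⟩
    ∣ p Δ q ∣ + 2 * (∣ T ─ r ∣ + ∣ T ∩ r ∣)              ≡⟨ regroup (∣ p Δ q ∣) (∣ T ─ r ∣) (∣ T ∩ r ∣) ⟩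
    (∣ p Δ q ∣ + 2 * ∣ T ─ r ∣) + 2 * ∣ T ∩ r ∣          ≤⟨ +-mono-≤ T─r-bound (*-monoʳ-≤ 2 T∩r-bound) ⟩
    ∣ p Δ r ∣ + ∣ q Δ r ∣ + 2 * ∣ s Δ t ∣                ∎
    where
    T = p ∩ s ∩ q
    regroup : ∀ a b c → a + 2 * (b + c) ≡ (a + 2 * b) + 2 * c
    regroup = solve-∀

    T⊆p∩q : T ⊆ p ∩ q
    T⊆p∩q x∈T with x∈p∩q⁻ p (s ∩ q) x∈T
    ... | x∈p , x∈s∩q = x∈p∩q⁺ (x∈p , p∩q⊆q s q x∈s∩q)

    T∩r⊆sΔt : T ∩ r ⊆ s Δ t
    T∩r⊆sΔt x∈T∩r with x∈p∩q⁻ T r x∈T∩r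
    ... | x∈T , x∈r = p⊆p∪q (t ─ s) (x∈p∧x∉q⇒x∈p─q (p∩q⊆p s q (p∩q⊆q p (s ∩ q) x∈T)) (r∩t=∅ x∈r))

    T─r-bound : ∣ p Δ q ∣ + 2 * ∣ T ─ r ∣ ≤ ∣ p Δ r ∣ + ∣ q Δ r ∣
    T─r-bound = ≤-trans (+-monoʳ-≤ (∣ p Δ q ∣) (*-monoʳ-≤ 2 ∣T─r∣≤∣p∩q─r∣)) (∣pΔq∣+2∣p∩q─r∣≤∣pΔr∣+∣qΔr∣ p q r)
      where
      ∣T─r∣≤∣p∩q─r∣ : ∣ T ─ r ∣ ≤ ∣ p ∩ q ─ r ∣
      ∣T─r∣≤∣p∩q─r∣ = p⊆q⇒∣p∣≤∣q∣ (─-monoˡ-⊆ r T⊆p∩q)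

    T∩r-bound : ∣ T ∩ r ∣ ≤ ∣ s Δ t ∣
    T∩r-bound = p⊆q⇒∣p∣≤∣q∣ T∩r⊆sΔt

open SubsetCounting using (∣pΔq∣+2∣p∩s∩q∣≤∣pΔr∣+∣qΔr∣+2∣sΔt∣)

module _ {n : ℕ} (C : Clustering n) where
  open import Data.Fin using (_≟_)
  open import Data.Fin.Subset using (_∈_; _∉_; inside; outside)
  open import Data.Vec using (tabulate)
  open import Data.Vec.Properties using (lookup∘tabulate; []=⇒lookup)
  open import Data.Bool using (if_then_else_)
  open import Relation.Nullary using (yes; no)
  open import Relation.Nullary.Decidable using (⌊_⌋)

  ∈-cluster⇒≡ : ∀ {u x} → x ∈ cluster C u → C x ≡ C u
  ∈-cluster⇒≡ {u} {x} x∈𝒞u with C x ≟ C u | trans (sym (lookup∘tabulate _ x)) ([]=⇒lookup x∈𝒞u)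
  ... | yes Cx≡Cu | _  = Cx≡Cu
  ... | no  _     | ()

  cluster-disjoint : ∀ {u v x} → C u ≢ C v → x ∈ cluster C u → x ∉ cluster C v
  cluster-disjoint Cu≢Cv x∈𝒞u x∈𝒞v = Cu≢Cv (trans (sym (∈-cluster⇒≡ x∈𝒞u)) (∈-cluster⇒≡ x∈𝒞v))

  cluster-cong : ∀ {w u} → C w ≡ C u → cluster C w ≡ cluster C u
  cluster-cong = cong (λ c → tabulate (λ x → if ⌊ C x ≟ c ⌋ then inside else outside))

  module _ (G : Graph n) where
    open import Data.Nat using (_+_; _*_; _≤_)
    open import Data.Nat.Properties using (module ≤-Reasoning)
    open ≤-Reasoning

    ∣N[w]ΔN[u]∣+2∣N[w]∩N[v]∩N[u]∣≤ρ : ∀ {u v w} → C u ≢ C v → C w ≡ C u →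
      ∣ N[ G ] w Δ N[ G ] u ∣ + 2 * ∣ N[ G ] w ∩ N[ G ] v ∩ N[ G ] u ∣ ≤ ρ G C w + ρ G C u + 2 * ρ G C v
    ∣N[w]ΔN[u]∣+2∣N[w]∩N[v]∩N[u]∣≤ρ {u} {v} {w} Cu≢Cv Cw≡Cu = begin
      ∣ N[ G ] w Δ N[ G ] u ∣ + 2 * ∣ N[ G ] w ∩ N[ G ] v ∩ N[ G ] u ∣
        ≤⟨ ∣pΔq∣+2∣p∩s∩q∣≤∣pΔr∣+∣qΔr∣+2∣sΔt∣ (N[ G ] w) (N[ G ] u) (cluster C u) (N[ G ] v) (cluster C v)
                                               (cluster-disjoint Cu≢Cv) ⟩
      ∣ N[ G ] w Δ cluster C u ∣ + ρ G C u + 2 * ρ G C v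
        ≡⟨ cong (λ 𝒞 → ∣ N[ G ] w Δ 𝒞 ∣ + ρ G C u + 2 * ρ G C v) (cluster-cong Cw≡Cu) ⟨
      ρ G C w + ρ G C u + 2 * ρ G C v
        ∎

open import Data.Rational using (ℚ; 0ℚ; 1ℚ; _≤_; _<_; _+_; _-_; _*_)
open import Data.Rational using (mkℚ; _/_; *≤*; -_)
open import Data.Rational.Properties using (normalize-coprime; ≤-reflexive; +-mono-≤; +-monoˡ-≤; *-monoˡ-≤-nonNeg; module ≤-Reasoning)
import Data.Nat as ℕ
import Data.Integer as ℤ
import Data.Integer.Properties as ℤ
open import Data.Rational.Solver using (module +-*-Solver)
open import Data.Nat.Coprimality using (1-coprimeTo) renaming (sym to coprime-sym)

toℚ≡mkℚ : ∀ k → toℚ k ≡ mkℚ (ℤ.+ k) 0 (coprime-sym (1-coprimeTo k))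
toℚ≡mkℚ k = normalize-coprime (coprime-sym (1-coprimeTo k))

toℚ-homo-+ : ∀ m n → toℚ (m ℕ.+ n) ≡ toℚ m + toℚ n
toℚ-homo-+ m n rewrite toℚ≡mkℚ m | toℚ≡mkℚ n =
  cong (_/ 1) (cong₂ ℤ._+_ (sym (ℤ.*-identityʳ (ℤ.+ m))) (sym (ℤ.*-identityʳ (ℤ.+ n))))

toℚ-homo-* : ∀ m n → toℚ (m ℕ.* n) ≡ toℚ m * toℚ n
toℚ-homo-* m n rewrite toℚ≡mkℚ m | toℚ≡mkℚ n = cong (_/ 1) (ℤ.pos-* m n)

toℚ-mono-≤ : ∀ {m n} → m ℕ.≤ n → toℚ m ≤ toℚ n
toℚ-mono-≤ {m} {n} m≤n rewrite toℚ≡mkℚ m | toℚ≡mkℚ n =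
  *≤* (subst₂ ℤ._≤_ (sym (ℤ.*-identityʳ (ℤ.+ m))) (sym (ℤ.*-identityʳ (ℤ.+ n))) (ℤ.+≤+ m≤n))

toℚ-homo-+-2* : ∀ m n → toℚ (m ℕ.+ 2 ℕ.* n) ≡ toℚ m + toℚ 2 * toℚ n
toℚ-homo-+-2* m n = trans (toℚ-homo-+ m (2 ℕ.* n)) (cong (toℚ m +_) (toℚ-homo-* 2 n))

d+2[φ+t]≤φ+φ+2φ⇒d≤2[φ-t] : ∀ d φ t → d + toℚ 2 * (φ + t) ≤ φ + φ + toℚ 2 * φ → d ≤ toℚ 2 * (φ - t)
d+2[φ+t]≤φ+φ+2φ⇒d≤2[φ-t] d φ t h = begin
  d                                              ≡⟨ cancel ⟨
  d + toℚ 2 * (φ + t) - toℚ 2 * (φ + t)          ≤⟨ +-monoˡ-≤ (- (toℚ 2 * (φ + t))) h ⟩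
  φ + φ + toℚ 2 * φ - toℚ 2 * (φ + t)            ≡⟨ collect ⟩
  toℚ 2 * (φ - t)                                ∎
  where
  open ≤-Reasoning
  open +-*-Solver
  cancel : d + toℚ 2 * (φ + t) - toℚ 2 * (φ + t) ≡ d
  cancel = solve 3 (λ d φ t → d :+ con (toℚ 2) :* (φ :+ t) :- con (toℚ 2) :* (φ :+ t) := d) refl d φ t
  collect : φ + φ + toℚ 2 * φ - toℚ 2 * (φ + t) ≡ toℚ 2 * (φ - t)
  collect = solve 2 (λ φ t → φ :+ φ :+ con (toℚ 2) :* φ :- con (toℚ 2) :* (φ :+ t) := con (toℚ 2) :* (φ :- t)) refl φ t

mainTheorem4 : ∀ {n : ℕ} (G : Graph n) (φ η : ℚ) → 0ℚ ≤ φ → 0ℚ ≤ η → η < 1ℚ →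
    (C : Clustering n) →
    -- obj(𝒞*) = max_u ρ(u) ≤ φ
    (∀ x → toℚ (ρ G C x) ≤ φ) →
    (u v w : Fin n) →
    (toℚ 3 + η) * φ < toℚ (deg G u) →
    (toℚ 3 + η) * φ < toℚ (deg G v) →
    C u ≢ C v →
    C w ≡ C u →
    toℚ (deg G w) ≤ (toℚ 3 + η) * φ →
    (t : ℚ) → 0ℚ < t →
    toℚ ∣ N[ G ] w ∩ N[ G ] v ∩ N[ G ] u ∣ ≡ φ + t →
    toℚ ∣ N[ G ] w Δ N[ G ] u ∣ ≤ toℚ 2 * (φ - t)
mainTheorem4 G φ _ _ _ _ C ρ≤φ u v w _ _ Cu≢Cv Cw≡Cu _ t _ ∣T∣≡φ+t =
  d+2[φ+t]≤φ+φ+2φ⇒d≤2[φ-t] (toℚ D) φ t (begin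
    toℚ D + toℚ 2 * (φ + t)                      ≡⟨ cong (λ a → toℚ D + toℚ 2 * a) ∣T∣≡φ+t ⟨
    toℚ D + toℚ 2 * toℚ T                        ≡⟨ toℚ-homo-+-2* D T ⟨
    toℚ (D ℕ.+ 2 ℕ.* T)                          ≤⟨ toℚ-mono-≤ (∣N[w]ΔN[u]∣+2∣N[w]∩N[v]∩N[u]∣≤ρ C G Cu≢Cv Cw≡Cu) ⟩
    toℚ (ρ G C w ℕ.+ ρ G C u ℕ.+ 2 ℕ.* ρ G C v)  ≡⟨ toℚ-homo-+-2* (ρ G C w ℕ.+ ρ G C u) (ρ G C v) ⟩
    toℚ (ρ G C w ℕ.+ ρ G C u) + toℚ 2 * toℚ (ρ G C v)
      ≤⟨ +-mono-≤ (≤-reflexive (toℚ-homo-+ (ρ G C w) (ρ G C u))) (*-monoˡ-≤-nonNeg (toℚ 2) (ρ≤φ v)) ⟩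
    toℚ (ρ G C w) + toℚ (ρ G C u) + toℚ 2 * φ    ≤⟨ +-monoˡ-≤ (toℚ 2 * φ) (+-mono-≤ (ρ≤φ w) (ρ≤φ u)) ⟩
    φ + φ + toℚ 2 * φ                            ∎)
  where
  open ≤-Reasoning
  D = ∣ N[ G ] w Δ N[ G ] u ∣
  T = ∣ N[ G ] w ∩ N[ G ] v ∩ N[ G ] u ∣
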